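{- Let $k\ge 3$, let $G$ be a graph containing no copy of $F_k$, and let $uv$ be an edge of $G$. If $uv$ is light, $|N(uv)|=k-1$, and for every $x\in N(uv)$ the edge $vx$ is heavy and the edge $ux$ is light, then $$\sum_{x\in N(uv)}w(uvx,u)=k-1;$$ otherwise $$\sum_{x\in N(uv)}w(uvx,u)\le k-\frac{3}{2}.$$
   Context: $F_k$ is the friendship graph: $k$ triangles sharing exactly one common vertex. For an edge $ab$, $N(ab)=N(a)\cap N(b)$. An edge $ab$ is heavy if $|N(ab)|\ge 2k-1$, medium if $k\le |N(ab)|\le 2k-2$, and light if $1\le |N(ab)|\le k-1$. For each triangle $T$ of $G$, a weight $1$ is distributed to its vertices via $w(T,\cdot)$ as follows: write $T=xyz$ with $|N(xy)|\ge |N(yz)|\ge |N(xz)|$. If $T$ has no heavy edge or no light edge, then $w(T,x)=w(T,y)=w(T,z)=\frac13$. If $xy$ is heavy, $yz$ is heavy or medium, and $xz$ is light, then $w(T,x)=w(T,z)=\frac12$ and $w(T,y)=0$. If $xy$ is heavy and $yz,xz$ are light, then $w(T,x)=w(T,y)=0$ and $w(T,z)=1$. -}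

module Defs where

open import Data.Nat as ℕ using (ℕ; _≤_; _∸_; _*_)
open import Data.Bool using (Bool; true; false; _∧_; if_then_else_)
open import Data.Fin using (Fin)
open import Data.List using (List; filterᵇ; length; foldr; map)
open import Data.List using () renaming (allFin to allFinL)
open import Data.Sum using (_⊎_; inj₁; inj₂)
open import Data.Unit using (⊤)
open import Data.Product using (_×_)
open import Data.Integer using (+_)
open import Data.Rational as ℚ using (ℚ; _/_; 0ℚ; 1ℚ; ½)
open import Function.Definitions using (Injective)
open import Relation.Binary.PropositionalEquality using (_≡_)
open import Relation.Nullary using (¬_)
open import Relation.Nullary.Decidable using (⌊_⌋)

record Graph (n : ℕ) : Set where
  field
    Adj    : Fin n → Fin n → Bool
    sym    : ∀ i j → Adj i j ≡ Adj j i
    irrefl : ∀ i → Adj i i ≡ false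
open Graph public

Edge : ∀ {n} → Graph n → Fin n → Fin n → Set
Edge G x y = Adj G x y ≡ true

Ncommon : ∀ {n} → Graph n → Fin n → Fin n → List (Fin n)
Ncommon {n} G a b = filterᵇ (λ x → Adj G a x ∧ Adj G b x) (allFinL n)

deg2 : ∀ {n} → Graph n → Fin n → Fin n → ℕ
deg2 G a b = length (Ncommon G a b)

Heavy : ℕ → ℕ → Set
Heavy k c = 2 * k ∸ 1 ≤ c

Medium : ℕ → ℕ → Set
Medium k c = k ≤ c × c ≤ 2 * k ∸ 2

Light : ℕ → ℕ → Set
Light k c = 1 ≤ c × c ≤ k ∸ 1

heavy? : ℕ → ℕ → Bool
heavy? k c = ⌊ 2 * k ∸ 1 ℕ.≤? c ⌋

light? : ℕ → ℕ → Bool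
light? k c = ⌊ 1 ℕ.≤? c ⌋ ∧ ⌊ c ℕ.≤? k ∸ 1 ⌋

count : Bool → Bool → Bool → ℕ
count a b c = (if a then 1 else 0) ℕ.+ (if b then 1 else 0) ℕ.+ (if c then 1 else 0)

-- Weight w(T, p) of a triangle T at its vertex p, where T = p q r and
--   a = |N(pq)|, b = |N(pr)| (the two edges at p), c = |N(qr)| (edge opposite p).
-- Paper's rule (T = xyz, |N(xy)| ≥ |N(yz)| ≥ |N(xz)|):
--  * no heavy edge or no light edge: 1/3 to each vertex;
--  * xy heavy, yz heavy/medium, xz light: x,z get 1/2, y gets 0
--    (y is the vertex opposite the unique light edge);
--  * xy heavy, yz and xz light: z gets 1, x,y get 0
--    (z is the vertex opposite the unique heavy edge).
weight : ℕ → ℕ → ℕ → ℕ → ℚ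
weight k a b c with count (heavy? k a) (heavy? k b) (heavy? k c)
                  | count (light? k a) (light? k b) (light? k c)
... | 0 | _ = + 1 / 3
... | _ | 0 = + 1 / 3
... | _ | 1 = if light? k c then 0ℚ else ½
... | _ | _ = if heavy? k c then 1ℚ else 0ℚ

w : ∀ {n} → ℕ → Graph n → Fin n → Fin n → Fin n → ℚ
w k G u v x = weight k (deg2 G u v) (deg2 G u x) (deg2 G v x)

sumℚ : List ℚ → ℚ
sumℚ = foldr ℚ._+_ 0ℚ

weightSum : ∀ {n} → ℕ → Graph n → Fin n → Fin n → ℚ
weightSum k G u v = sumℚ (map (w k G u v) (Ncommon G u v))

-- A copy of the friendship graph F_k in G (as a subgraph, not necessarily induced):
-- centre c, triangles c (a i) (b i), all 2k+1 vertices distinct.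
fkVertex : ∀ {k n} → Fin n → (Fin k → Fin n) → (Fin k → Fin n) → (Fin k ⊎ Fin k) ⊎ ⊤ → Fin n
fkVertex c a b (inj₁ (inj₁ i)) = a i
fkVertex c a b (inj₁ (inj₂ i)) = b i
fkVertex c a b (inj₂ _) = c

record FkCopy (k : ℕ) {n : ℕ} (G : Graph n) : Set where
  field
    centre : Fin n
    a b    : Fin k → Fin n
    distinct : Injective _≡_ _≡_ (fkVertex centre a b)
    edge-ca  : ∀ i → Edge G centre (a i)
    edge-cb  : ∀ i → Edge G centre (b i)
    edge-ab  : ∀ i → Edge G (a i) (b i)

FkFree : (k : ℕ) → ∀ {n} → Graph n → Set
FkFree k G = ¬ FkCopy k G

Special : ℕ → ∀ {n} → Graph n → Fin n → Fin n → Set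
Special k G u v =
  Light k (deg2 G u v) × deg2 G u v ≡ k ∸ 1 ×
  (∀ x → Edge G u x → Edge G v x → Heavy k (deg2 G v x) × Light k (deg2 G u x))

-- Counting weights in sixths, every w(uvx, u) is one of 0, 2, 3, 6 and depends only on the
-- classes of uv, ux and vx; the claim becomes: the sum is at most 6k − 9, and 6k − 6 in the
-- special configuration.
--   uv light: a term is at most 3 unless vx is heavy and ux light, when it is 6; as
--     |N(uv)| ≤ k − 1, only the special configuration reaches more than 6k − 9.
--   uv medium: a term is at most 2, or 3 when vx is heavy, and fewer than k − 1 of the
--     edges vx are heavy.
--   uv heavy: a term is at most 3 and vanishes when vx is light, and fewer than 2k − 2 of
--     the edges vx are not light.
-- Both counts come from F_k-freeness: otherwise k triangles through v, disjoint apart from v,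
-- can be found. For heavy vx they are picked greedily, each heavy x choosing a fresh partner.
-- For merely non-light vx a family of such triangles is enlarged by augmentation: two unused
-- x, z that cannot be attached directly see many vertices of the family, so some triangle
-- v a b of it sees three of xa, xb, za, zb and can be traded for v x a and v b z.

module Submission where

open import Defs renaming (sym to Adj-sym)
open import Data.Nat using (ℕ; _≤_)
open import Data.Fin using (Fin)
open import Data.Product using (_×_)
open import Data.Integer using (+_)
open import Data.Rational using (ℚ; _/_; _-_; 1ℚ) renaming (_≤_ to _≤ℚ_)
open import Relation.Binary.PropositionalEquality using (_≡_)
open import Relation.Nullary using (¬_)

open import Data.Nat as ℕ using (suc; _+_; _*_; _∸_; _<_; _≤ᵇ_; z≤n; s≤s)
import Data.Nat.Properties as ℕ
open import Data.Nat.ListAction using (sum)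
open import Data.Nat.Tactic.RingSolver using (solve-∀)
import Data.Integer as ℤ
import Data.Integer.Properties as ℤ
import Data.Integer.Tactic.RingSolver as ℤ
open import Data.Rational as ℚ using (0ℚ; ½; toℚᵘ)
import Data.Rational.Properties as ℚ
open import Data.Rational.Unnormalised as ℚᵘ using (mkℚᵘ; *≡*; *≤*) renaming (_≃_ to _≃ᵘ_)
import Data.Rational.Unnormalised.Properties as ℚᵘ
open import Data.Bool using (Bool; true; false; _∧_; not; T; if_then_else_)
open import Data.Bool.Properties using (T-≡; T-∧)
open import Data.Empty using (⊥)
open import Data.Unit using (tt)
open import Data.Fin using (zero; suc)
import Data.Fin.Properties as Fin
open import Data.List using (List; []; _∷_; length; lookup; map; filterᵇ; _++_; take)
open import Data.List using () renaming (allFin to allFinL)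
open import Data.List.Properties
  using (length-removeAt′; length-filter; length-++; length-take; map-cong; filter-notAll)
open import Data.List.Membership.Propositional using (_∈_; _∉_; _─_; find)
open import Data.List.Membership.Propositional.Properties
  using (∈-filter⁺; ∈-filter⁻; ∈-allFin; ∈-lookup; ∈-++⁺ˡ; ∈-++⁺ʳ; ∈-++⁻; ∈-length)
open import Data.List.Relation.Binary.Subset.Propositional using (_⊆_)
import Data.List.Relation.Binary.Sublist.Propositional as Sublist
open import Data.List.Relation.Binary.Sublist.Propositional.Properties using (take-⊆)
open import Data.List.Relation.Unary.Any using (here; there)
open import Data.List.Relation.Unary.All as All using (All; []; _∷_; all?)
open import Data.List.Relation.Unary.All.Properties using (All¬⇒¬Any; ¬All⇒Any¬)
open import Data.List.Relation.Unary.Unique.Propositional using (Unique; []; _∷_)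
import Data.List.Relation.Unary.Unique.Propositional.Properties as Unique
open import Data.Product using (∃; _,_; proj₁; proj₂)
open import Data.Sum using (_⊎_; inj₁; inj₂)
open import Function using (_∘_; Equivalence)
open import Relation.Nullary using (yes; no)
open import Relation.Nullary.Decidable using (T?)
open import Relation.Nullary.Negation using (contradiction)
open import Relation.Binary.Definitions using (DecidableEquality)
open import Relation.Binary.PropositionalEquality
  using (_≢_; refl; sym; trans; cong; cong₂; subst; subst₂; module ≡-Reasoning)

module _ {A : Set} where

  ∈-─ : ∀ {x y : A} {xs} (x∈xs : x ∈ xs) → y ∈ xs → y ≢ x → y ∈ xs ─ x∈xs
  ∈-─ (here refl) (here refl) y≢x = contradiction refl y≢x
  ∈-─ (here refl) (there y∈xs) _  = y∈xs
  ∈-─ (there _)   (here refl)  _  = here refl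
  ∈-─ (there x∈xs) (there y∈xs) y≢x = there (∈-─ x∈xs y∈xs y≢x)

  ∉-∷⁺ : ∀ {x y : A} {ys} → x ≢ y → x ∉ ys → x ∉ y ∷ ys
  ∉-∷⁺ x≢y _    (here x≡y)    = x≢y x≡y
  ∉-∷⁺ _   x∉ys (there x∈ys) = x∉ys x∈ys

  ∉-∷⁻ : ∀ {x y : A} {ys} → x ∉ y ∷ ys → x ≢ y × x ∉ ys
  ∉-∷⁻ x∉ = x∉ ∘ here , x∉ ∘ there

  Unique-⊆⇒length-≤ : ∀ {xs ys : List A} → Unique xs → xs ⊆ ys → length xs ≤ length ys
  Unique-⊆⇒length-≤ {[]} _ _ = z≤n
  Unique-⊆⇒length-≤ {x ∷ xs} {ys} (x∉xs ∷ uxs) xs⊆ys =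
    subst (suc (length xs) ≤_) (sym (length-removeAt′ ys _))
      (s≤s (Unique-⊆⇒length-≤ uxs λ y∈xs → ∈-─ (xs⊆ys (here refl)) (xs⊆ys (there y∈xs))
        λ { refl → All.lookup x∉xs y∈xs refl }))

  sum-≤-indicator : ∀ (f : A → ℕ) (p : A → Bool) α β L →
    (∀ {x} → x ∈ L → f x ≤ α + (if p x then β else 0)) →
    sum (map f L) ≤ α * length L + β * length (filterᵇ p L)
  sum-≤-indicator f p α β []      _     = z≤n
  sum-≤-indicator f p α β (x ∷ L) bound with p x | bound (here refl)
  ... | true  | fx≤ = ℕ.≤-trans (ℕ.+-mono-≤ fx≤ (sum-≤-indicator f p α β L (bound ∘ there)))
                              (ℕ.≤-reflexive (regroup α β (length L) _))
    where
    regroup : ∀ α β l c → (α + β) + (α * l + β * c) ≡ α * suc l + β * suc c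
    regroup = solve-∀
  ... | false | fx≤ = ℕ.≤-trans (ℕ.+-mono-≤ fx≤ (sum-≤-indicator f p α β L (bound ∘ there)))
                              (ℕ.≤-reflexive (regroup α β (length L) _))
    where
    regroup : ∀ α β l c → (α + 0) + (α * l + β * c) ≡ α * suc l + β * c
    regroup = solve-∀

  sum-constant : ∀ (f : A → ℕ) c L → (∀ {x} → x ∈ L → f x ≡ c) → sum (map f L) ≡ c * length L
  sum-constant f c []      _    = sym (ℕ.*-zeroʳ c)
  sum-constant f c (x ∷ L) f≡c =
    trans (cong₂ _+_ (f≡c (here refl)) (sum-constant f c L (f≡c ∘ there))) (sym (ℕ.*-suc c (length L)))

module _ {A : Set} (_≟_ : DecidableEquality A) where

  open import Data.List.Membership.DecPropositional _≟_ using (_∈?_)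

  ⊆-or-∃-∉ : ∀ (xs ys : List A) → xs ⊆ ys ⊎ ∃ λ x → x ∈ xs × x ∉ ys
  ⊆-or-∃-∉ xs ys with all? (_∈? ys) xs
  ... | yes xs⊆ys = inj₁ (All.lookup xs⊆ys)
  ... | no xs⊈ys  = inj₂ (find (¬All⇒Any¬ (_∈? ys) xs xs⊈ys))

  ∃-∉ : ∀ {xs ys : List A} → Unique xs → length ys < length xs → ∃ λ x → x ∈ xs × x ∉ ys
  ∃-∉ {xs} {ys} uxs ys<xs with ⊆-or-∃-∉ xs ys
  ... | inj₁ xs⊆ys = contradiction (Unique-⊆⇒length-≤ uxs xs⊆ys) (ℕ.<⇒≱ ys<xs)
  ... | inj₂ x∉ys  = x∉ys

-- Rationals counted in sixths

sixths : ℕ → ℚ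
sixths m = + m / 6

toℚᵘ-sixths : ∀ m → toℚᵘ (sixths m) ≃ᵘ mkℚᵘ (+ m) 5
toℚᵘ-sixths m = ℚ.toℚᵘ-fromℚᵘ (mkℚᵘ (+ m) 5)

sixths-+ : ∀ m n → sixths m ℚ.+ sixths n ≡ sixths (m ℕ.+ n)
sixths-+ m n = ℚ.toℚᵘ-injective (begin
  toℚᵘ (sixths m ℚ.+ sixths n)            ≈⟨ ℚ.toℚᵘ-homo-+ (sixths m) (sixths n) ⟩
  toℚᵘ (sixths m) ℚᵘ.+ toℚᵘ (sixths n)  ≈⟨ ℚᵘ.+-cong (toℚᵘ-sixths m) (toℚᵘ-sixths n) ⟩
  mkℚᵘ (+ m) 5 ℚᵘ.+ mkℚᵘ (+ n) 5        ≈⟨ *≡* numerators ⟩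
  mkℚᵘ (+ (m ℕ.+ n)) 5                  ≈⟨ toℚᵘ-sixths (m ℕ.+ n) ⟨
  toℚᵘ (sixths (m ℕ.+ n))               ∎)
  where
  open ℚᵘ.≃-Reasoning
  common-denominator : ∀ a b → (a ℤ.* + 6 ℤ.+ b ℤ.* + 6) ℤ.* + 6 ≡ (a ℤ.+ b) ℤ.* + 36
  common-denominator = ℤ.solve-∀
  numerators : (+ m ℤ.* + 6 ℤ.+ + n ℤ.* + 6) ℤ.* + 6 ≡ + (m ℕ.+ n) ℤ.* + 36
  numerators rewrite ℤ.pos-+ m n = common-denominator (+ m) (+ n)

sixths-mono-≤ : ∀ {m n} → m ≤ n → sixths m ≤ℚ sixths n
sixths-mono-≤ {m} {n} m≤n = ℚ.toℚᵘ-cancel-≤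
  (ℚᵘ.≤-respˡ-≃ (ℚᵘ.≃-sym (toℚᵘ-sixths m)) (ℚᵘ.≤-respʳ-≃ (ℚᵘ.≃-sym (toℚᵘ-sixths n))
    (*≤* (ℤ.*-monoʳ-≤-nonNeg (+ 6) (ℤ.+≤+ m≤n)))))

/1≡sixths : ∀ m → + m / 1 ≡ sixths (6 ℕ.* m)
/1≡sixths m = ℚ.toℚᵘ-injective (ℚᵘ.≃-trans (ℚ.toℚᵘ-fromℚᵘ (mkℚᵘ (+ m) 0))
  (ℚᵘ.≃-trans (*≡* numerators) (ℚᵘ.≃-sym (toℚᵘ-sixths (6 ℕ.* m)))))
  where
  numerators : + m ℤ.* + 6 ≡ + (6 ℕ.* m) ℤ.* + 1
  numerators = trans (ℤ.*-comm (+ m) (+ 6)) (trans (sym (ℤ.pos-* 6 m)) (sym (ℤ.*-identityʳ _)))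

integer-minus-sixths : ∀ k r s → s + r ≡ 6 * k → + k / 1 - sixths r ≡ sixths s
integer-minus-sixths k r s s+r≡6k = begin
  + k / 1 - sixths r                      ≡⟨ cong (_- sixths r) (/1≡sixths k) ⟩
  sixths (6 ℕ.* k) - sixths r             ≡⟨ cong (λ l → sixths l - sixths r) s+r≡6k ⟨
  sixths (s ℕ.+ r) - sixths r             ≡⟨ cong (_- sixths r) (sixths-+ s r) ⟨
  (sixths s ℚ.+ sixths r) - sixths r        ≡⟨ ℚ.+-assoc (sixths s) (sixths r) _ ⟩
  sixths s ℚ.+ (sixths r - sixths r)        ≡⟨ cong (λ q → sixths s ℚ.+ q) (ℚ.+-inverseʳ (sixths r)) ⟩
  sixths s ℚ.+ 0ℚ                           ≡⟨ ℚ.+-identityʳ _ ⟩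
  sixths s                                ∎
  where open ≡-Reasoning

sixths≤integer-minus-sixths : ∀ k r s → s + r ≤ 6 * k → sixths s ≤ℚ + k / 1 - sixths r
sixths≤integer-minus-sixths k r s s+r≤6k =
  subst (sixths s ≤ℚ_) (sym (integer-minus-sixths k r (6 ℕ.* k ∸ r) (ℕ.m∸n+n≡m (ℕ.m+n≤o⇒n≤o s s+r≤6k))))
        (sixths-mono-≤ (ℕ.m+n≤o⇒m≤o∸n s s+r≤6k))

sumℚ-sixths : ∀ {A : Set} (f : A → ℕ) L → sumℚ (map (sixths ∘ f) L) ≡ sixths (sum (map f L))
sumℚ-sixths f []      = refl
sumℚ-sixths f (x ∷ L) = trans (cong (sixths (f x) ℚ.+_) (sumℚ-sixths f L)) (sixths-+ (f x) (sum (map f L)))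

sixths-6≡1ℚ : sixths 6 ≡ 1ℚ
sixths-6≡1ℚ = refl

sixths-9≡3/2 : sixths 9 ≡ + 3 / 2
sixths-9≡3/2 = refl

-- medium also covers |N(ab)| = 0, which the paper leaves unclassified.
data EdgeClass : Set where
  light medium heavy : EdgeClass

isLight isHeavy : EdgeClass → Bool
isLight light = true
isLight _     = false
isHeavy heavy = true
isHeavy _     = false

classify : ℕ → ℕ → EdgeClass
classify k c with light? k c | heavy? k c
... | true  | _     = light
... | false | true  = heavy
... | false | false = medium

data Classification (k c : ℕ) : EdgeClass → Set where
  light  : Light k c → Classification k c light
  medium : ¬ Light k c → ¬ Heavy k c → Classification k c medium
  heavy  : ¬ Light k c → Heavy k c → Classification k c heavy

classification : ∀ k c → Classification k c (classify k c)
classification k c with 1 ℕ.≤? c | c ℕ.≤? k ∸ 1 | 2 * k ∸ 1 ℕ.≤? c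
... | yes p | yes q | _ = light (p , q)
... | yes p | no ¬q | yes h = heavy (λ (_ , q) → ¬q q) h
... | yes p | no ¬q | no ¬h = medium (λ (_ , q) → ¬q q) ¬h
... | no ¬p | _ | yes h = heavy (λ (p , _) → ¬p p) h
... | no ¬p | _ | no ¬h = medium (λ (p , _) → ¬p p) ¬h

heavy⇒¬light : ∀ {m c} → Heavy (suc m) c → ¬ Light (suc m) c
heavy⇒¬light {m} h (_ , c≤m) = ℕ.<⇒≱ (ℕ.m<m+n m (s≤s z≤n)) (ℕ.≤-trans h c≤m)

light?≡isLight : ∀ k c → light? k c ≡ isLight (classify k c)
light?≡isLight k c with light? k c | heavy? k c
... | true  | _     = refl
... | false | true  = refl
... | false | false = refl

heavy?≡isHeavy : ∀ m c → heavy? (suc m) c ≡ isHeavy (classify (suc m) c)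
heavy?≡isHeavy m c with 1 ℕ.≤? c | c ℕ.≤? m | 2 * suc m ∸ 1 ℕ.≤? c
... | yes p | yes q | yes h = contradiction (p , q) (heavy⇒¬light h)
... | yes _ | yes _ | no _  = refl
... | yes _ | no _  | yes _ = refl
... | yes _ | no _  | no _  = refl
... | no _  | _     | yes _ = refl
... | no _  | _     | no _  = refl

classify-light : ∀ {k c} → Light k c → classify k c ≡ light
classify-light {k} {c} l with classify k c | classification k c
... | light  | _          = refl
... | medium | medium ¬l _ = contradiction l ¬l
... | heavy  | heavy ¬l _  = contradiction l ¬l

classify-heavy : ∀ {m c} → Heavy (suc m) c → classify (suc m) c ≡ heavy
classify-heavy {m} {c} h with classify (suc m) c | classification (suc m) c
... | light  | light l     = contradiction l (heavy⇒¬light h)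
... | medium | medium _ ¬h = contradiction h ¬h
... | heavy  | _           = refl

-- The rule of Defs.weight with its values 1/3, 0, 1/2, 1 abstracted, so that they can be
-- counted in sixths.
rule : {A : Set} (third none half one : A) (ha hb hc la lb lc : Bool) → A
rule third none half one ha hb hc la lb lc with count ha hb hc | count la lb lc
... | 0     | _           = third
... | suc _ | 0           = third
... | suc _ | 1           = if lc then none else half
... | suc _ | suc (suc _) = if hc then one else none

rule-natural : ∀ {A B : Set} (f : A → B) third none half one ha hb hc la lb lc →
  f (rule third none half one ha hb hc la lb lc) ≡ rule (f third) (f none) (f half) (f one) ha hb hc la lb lc
rule-natural f third none half one ha hb hc la lb lc with count ha hb hc | count la lb lc
... | 0     | _           = refl
... | suc _ | 0           = refl
... | suc _ | 1           with lc
...   | true  = refl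
...   | false = refl
rule-natural f third none half one ha hb hc la lb lc | suc _ | suc (suc _) with hc
...   | true  = refl
...   | false = refl

weight≡rule : ∀ k a b c → weight k a b c ≡
  rule (+ 1 / 3) 0ℚ ½ 1ℚ (heavy? k a) (heavy? k b) (heavy? k c) (light? k a) (light? k b) (light? k c)
weight≡rule k a b c with count (heavy? k a) (heavy? k b) (heavy? k c)
                       | count (light? k a) (light? k b) (light? k c)
... | 0     | _ = refl
... | suc _ | 0 = refl
... | suc _ | 1 with light? k c
...   | true  = refl
...   | false = refl
weight≡rule k a b c | suc _ | suc (suc _) with heavy? k c
...   | true  = refl
...   | false = refl

classWeight : EdgeClass → EdgeClass → EdgeClass → ℕ
classWeight A B C = rule 2 0 3 6 (isHeavy A) (isHeavy B) (isHeavy C) (isLight A) (isLight B) (isLight C)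

weight≡classWeight : ∀ m a b c → let k = suc m in
  weight k a b c ≡ sixths (classWeight (classify k a) (classify k b) (classify k c))
weight≡classWeight m a b c = begin
  weight k a b c
    ≡⟨ weight≡rule k a b c ⟩
  rule (+ 1 / 3) 0ℚ ½ 1ℚ (heavy? k a) (heavy? k b) (heavy? k c) (light? k a) (light? k b) (light? k c)
    ≡⟨ flags-classify (heavy?≡isHeavy m a) (heavy?≡isHeavy m b) (heavy?≡isHeavy m c)
                      (light?≡isLight k a) (light?≡isLight k b) (light?≡isLight k c) ⟩
  rule (sixths 2) (sixths 0) (sixths 3) (sixths 6) (isHeavy A) (isHeavy B) (isHeavy C) (isLight A) (isLight B) (isLight C)
    ≡⟨ rule-natural sixths 2 0 3 6 (isHeavy A) (isHeavy B) (isHeavy C) (isLight A) (isLight B) (isLight C) ⟨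
  sixths (classWeight A B C) ∎
  where
  open ≡-Reasoning
  k = suc m
  A = classify k a
  B = classify k b
  C = classify k c
  flags-classify : ∀ {ha hb hc la lb lc ha′ hb′ hc′ la′ lb′ lc′} →
    ha ≡ ha′ → hb ≡ hb′ → hc ≡ hc′ → la ≡ la′ → lb ≡ lb′ → lc ≡ lc′ →
    rule (+ 1 / 3) 0ℚ ½ 1ℚ ha hb hc la lb lc ≡
    rule (sixths 2) (sixths 0) (sixths 3) (sixths 6) ha′ hb′ hc′ la′ lb′ lc′
  flags-classify refl refl refl refl refl refl = refl

private
  ≤-by-evaluation : ∀ {m n} {_ : T (m ≤ᵇ n)} → m ≤ n
  ≤-by-evaluation {m} {n} {m≤ᵇn} = ℕ.≤ᵇ⇒≤ m n m≤ᵇn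

classWeight-light : ∀ B C → classWeight light B C ≤ 3 + (if isHeavy C ∧ isLight B then 3 else 0)
classWeight-light light  light  = ≤-by-evaluation
classWeight-light light  medium = ≤-by-evaluation
classWeight-light light  heavy  = ≤-by-evaluation
classWeight-light medium light  = ≤-by-evaluation
classWeight-light medium medium = ≤-by-evaluation
classWeight-light medium heavy  = ≤-by-evaluation
classWeight-light heavy  light  = ≤-by-evaluation
classWeight-light heavy  medium = ≤-by-evaluation
classWeight-light heavy  heavy  = ≤-by-evaluation

classWeight-medium : ∀ B C → classWeight medium B C ≤ 2 + (if isHeavy C then 1 else 0)
classWeight-medium light  light  = ≤-by-evaluation
classWeight-medium light  medium = ≤-by-evaluation
classWeight-medium light  heavy  = ≤-by-evaluation
classWeight-medium medium light  = ≤-by-evaluation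
classWeight-medium medium medium = ≤-by-evaluation
classWeight-medium medium heavy  = ≤-by-evaluation
classWeight-medium heavy  light  = ≤-by-evaluation
classWeight-medium heavy  medium = ≤-by-evaluation
classWeight-medium heavy  heavy  = ≤-by-evaluation

classWeight-heavy : ∀ B C → classWeight heavy B C ≤ 0 + (if not (isLight C) then 3 else 0)
classWeight-heavy light  light  = ≤-by-evaluation
classWeight-heavy light  medium = ≤-by-evaluation
classWeight-heavy light  heavy  = ≤-by-evaluation
classWeight-heavy medium light  = ≤-by-evaluation
classWeight-heavy medium medium = ≤-by-evaluation
classWeight-heavy medium heavy  = ≤-by-evaluation
classWeight-heavy heavy  light  = ≤-by-evaluation
classWeight-heavy heavy  medium = ≤-by-evaluation
classWeight-heavy heavy  heavy  = ≤-by-evaluation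

isHeavy⇒Heavy : ∀ {k c} → T (isHeavy (classify k c)) → Heavy k c
isHeavy⇒Heavy {k} {c} t with classify k c | classification k c | t
... | heavy | heavy _ h | _ = h

isLight⇒Light : ∀ {k c} → T (isLight (classify k c)) → Light k c
isLight⇒Light {k} {c} t with classify k c | classification k c | t
... | light | light l | _ = l

¬Light⇒≥ : ∀ {m c} → ¬ Light (suc m) c → 1 ≤ c → suc m ≤ c
¬Light⇒≥ ¬l 1≤c = ℕ.≰⇒> λ c≤m → ¬l (1≤c , c≤m)

¬isLight⇒≥ : ∀ {m c} → T (not (isLight (classify (suc m) c))) → 1 ≤ c → suc m ≤ c
¬isLight⇒≥ {m} {c} t with classify (suc m) c | classification (suc m) c | t
... | medium | medium ¬l _ | _ = ¬Light⇒≥ ¬l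
... | heavy  | heavy ¬l _  | _ = ¬Light⇒≥ ¬l

-- Fans: triangles sharing one vertex

module _ {n : ℕ} (G : Graph n) where

  private
    V = Fin n

  Edge-sym : ∀ {x y} → Edge G x y → Edge G y x
  Edge-sym {x} {y} e = trans (Adj-sym G y x) e

  Edge⇒≢ : ∀ {x y} → Edge G x y → x ≢ y
  Edge⇒≢ {x} e refl with () ← trans (sym e) (irrefl G x)

  ∈Ncommon⁻ : ∀ {a b x} → x ∈ Ncommon G a b → Edge G a x × Edge G b x
  ∈Ncommon⁻ {a} {b} {x} x∈N
    with Adj G a x | Adj G b x | ∈-filter⁻ (T? ∘ λ y → Adj G a y ∧ Adj G b y) {xs = allFinL n} x∈N
  ... | true | true | _ = refl , refl

  ∈Ncommon⁺ : ∀ {a b x} → Edge G a x → Edge G b x → x ∈ Ncommon G a b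
  ∈Ncommon⁺ {a} {b} {x} ax bx = ∈-filter⁺ (T? ∘ λ y → Adj G a y ∧ Adj G b y) (∈-allFin x) adjacent
    where
    adjacent : T (Adj G a x ∧ Adj G b x)
    adjacent rewrite ax | bx = tt

  Ncommon-unique : ∀ a b → Unique (Ncommon G a b)
  Ncommon-unique a b = Unique.filter⁺ (T? ∘ λ y → Adj G a y ∧ Adj G b y) (Unique.allFin⁺ n)

  Blade : V → V × V → Set
  Blade v (a , b) = Edge G v a × Edge G v b × Edge G a b

  vertices : List (V × V) → List V
  vertices []             = []
  vertices ((a , b) ∷ ps) = a ∷ b ∷ vertices ps

  record Fan (v : V) (avoid : List V) (ps : List (V × V)) : Set where
    field
      distinct : Unique (vertices ps)
      blades   : All (Blade v) ps
      avoids   : ∀ {y} → y ∈ vertices ps → y ∉ avoid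
  open Fan

  fan-[] : ∀ {v avoid} → Fan v avoid []
  fan-[] = record { distinct = [] ; blades = [] ; avoids = λ () }

  fan-∷ : ∀ {v avoid ps a b} → Fan v avoid ps → Blade v (a , b) →
          a ∉ vertices ps → b ∉ vertices ps → a ∉ avoid → b ∉ avoid → Fan v avoid ((a , b) ∷ ps)
  fan-∷ {v} {avoid} {ps} {a} {b} fan blade@(_ , _ , ab) a∉ps b∉ps a∉avoid b∉avoid = record
    { distinct = All.tabulate a-fresh ∷ All.tabulate (λ y∈ps b≡y → b∉ps (subst (_∈ vertices ps) (sym b≡y) y∈ps))
                 ∷ distinct fan
    ; blades   = blade ∷ blades fan
    ; avoids   = λ { (here refl) → a∉avoid ; (there (here refl)) → b∉avoid ; (there (there y∈ps)) → avoids fan y∈ps } }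
    where
    a-fresh : ∀ {y} → y ∈ b ∷ vertices ps → a ≢ y
    a-fresh (here refl)  = Edge⇒≢ ab
    a-fresh (there y∈ps) refl = a∉ps y∈ps

  fan-tail : ∀ {v avoid p ps} → Fan v avoid (p ∷ ps) → Fan v avoid ps
  fan-tail fan with distinct fan | blades fan
  ... | _ ∷ _ ∷ uniq | _ ∷ bl =
    record { distinct = uniq ; blades = bl ; avoids = λ y∈ps → avoids fan (there (there y∈ps)) }

  fan-head-fresh : ∀ {v avoid a b ps} → Fan v avoid ((a , b) ∷ ps) → a ∉ vertices ps × b ∉ vertices ps
  fan-head-fresh fan with distinct fan
  ... | a∉ ∷ b∉ ∷ _ = (λ a∈ → All.lookup a∉ (there a∈) refl) , (λ b∈ → All.lookup b∉ b∈ refl)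

  fan-avoiding-fewer : ∀ {v avoid avoid′ ps} → avoid ⊆ avoid′ → Fan v avoid′ ps → Fan v avoid ps
  fan-avoiding-fewer ⊆ fan =
    record { distinct = distinct fan ; blades = blades fan ; avoids = λ y∈ps y∈ → avoids fan y∈ps (⊆ y∈) }

  vertices-length : ∀ ps → length (vertices ps) ≡ length ps + length ps
  vertices-length []       = refl
  vertices-length (_ ∷ ps) = cong suc (trans (cong suc (vertices-length ps)) (sym (ℕ.+-suc (length ps) (length ps))))

  private
    fst snd : (ps : List (V × V)) → Fin (length ps) → V
    fst ps i = proj₁ (lookup ps i)
    snd ps i = proj₂ (lookup ps i)

    fst∈ : ∀ ps i → fst ps i ∈ vertices ps
    fst∈ (_ ∷ _)  zero    = here refl
    fst∈ (_ ∷ ps) (suc i) = there (there (fst∈ ps i))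

    snd∈ : ∀ ps i → snd ps i ∈ vertices ps
    snd∈ (_ ∷ _)  zero    = there (here refl)
    snd∈ (_ ∷ ps) (suc i) = there (there (snd∈ ps i))

    fst-injective : ∀ ps → Unique (vertices ps) → ∀ i j → fst ps i ≡ fst ps j → i ≡ j
    fst-injective (_ ∷ _)  _                 zero    zero    _  = refl
    fst-injective (_ ∷ ps) (a≢ ∷ _)          zero    (suc j) eq = contradiction (there (subst (_∈ _) (sym eq) (fst∈ ps j))) (All¬⇒¬Any a≢)
    fst-injective (_ ∷ ps) (a≢ ∷ _)          (suc i) zero    eq = contradiction (there (subst (_∈ _) eq (fst∈ ps i))) (All¬⇒¬Any a≢)
    fst-injective (_ ∷ ps) (_ ∷ _ ∷ uniq)    (suc i) (suc j) eq = cong suc (fst-injective ps uniq i j eq)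

    snd-injective : ∀ ps → Unique (vertices ps) → ∀ i j → snd ps i ≡ snd ps j → i ≡ j
    snd-injective (_ ∷ _)  _                 zero    zero    _  = refl
    snd-injective (_ ∷ ps) (_ ∷ b≢ ∷ _)      zero    (suc j) eq = contradiction (subst (_∈ _) (sym eq) (snd∈ ps j)) (All¬⇒¬Any b≢)
    snd-injective (_ ∷ ps) (_ ∷ b≢ ∷ _)      (suc i) zero    eq = contradiction (subst (_∈ _) eq (snd∈ ps i)) (All¬⇒¬Any b≢)
    snd-injective (_ ∷ ps) (_ ∷ _ ∷ uniq)    (suc i) (suc j) eq = cong suc (snd-injective ps uniq i j eq)

    fst≢snd : ∀ ps → Unique (vertices ps) → ∀ i j → fst ps i ≢ snd ps j
    fst≢snd (_ ∷ _)  (a≢ ∷ _)       zero    zero    eq = All¬⇒¬Any a≢ (here eq)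
    fst≢snd (_ ∷ ps) (a≢ ∷ _)       zero    (suc j) eq = All¬⇒¬Any a≢ (there (subst (_∈ _) (sym eq) (snd∈ ps j)))
    fst≢snd (_ ∷ ps) (_ ∷ b≢ ∷ _)   (suc i) zero    eq = All¬⇒¬Any b≢ (subst (_∈ _) eq (fst∈ ps i))
    fst≢snd (_ ∷ ps) (_ ∷ _ ∷ uniq) (suc i) (suc j) eq = fst≢snd ps uniq i j eq

  fan→copy : ∀ {v avoid ps} → Fan v avoid ps → FkCopy (length ps) G
  fan→copy {v} {_} {ps} fan = record
    { centre  = v
    ; a       = fst ps
    ; b       = snd ps
    ; distinct = injective
    ; edge-ca = λ i → proj₁ (blade i)
    ; edge-cb = λ i → proj₁ (proj₂ (blade i))
    ; edge-ab = λ i → proj₂ (proj₂ (blade i))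
    }
    where
    blade : ∀ i → Blade v (lookup ps i)
    blade i = All.lookup (blades fan) (∈-lookup i)
    uniq = distinct fan
    injective : ∀ {x y} → fkVertex v (fst ps) (snd ps) x ≡ fkVertex v (fst ps) (snd ps) y → x ≡ y
    injective {inj₁ (inj₁ i)} {inj₁ (inj₁ j)} eq = cong (inj₁ ∘ inj₁) (fst-injective ps uniq i j eq)
    injective {inj₁ (inj₁ i)} {inj₁ (inj₂ j)} eq = contradiction eq (fst≢snd ps uniq i j)
    injective {inj₁ (inj₁ i)} {inj₂ _}        eq = contradiction (sym eq) (Edge⇒≢ (proj₁ (blade i)))
    injective {inj₁ (inj₂ i)} {inj₁ (inj₁ j)} eq = contradiction (sym eq) (fst≢snd ps uniq j i)
    injective {inj₁ (inj₂ i)} {inj₁ (inj₂ j)} eq = cong (inj₁ ∘ inj₂) (snd-injective ps uniq i j eq)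
    injective {inj₁ (inj₂ i)} {inj₂ _}        eq = contradiction (sym eq) (Edge⇒≢ (proj₁ (proj₂ (blade i))))
    injective {inj₂ _}        {inj₁ (inj₁ j)} eq = contradiction eq (Edge⇒≢ (proj₁ (blade j)))
    injective {inj₂ _}        {inj₁ (inj₂ j)} eq = contradiction eq (Edge⇒≢ (proj₁ (proj₂ (blade j))))
    injective {inj₂ _}        {inj₂ _}        _  = refl

  adjacency : V → V → ℕ
  adjacency x y = if Adj G x y then 1 else 0

  neighboursIn : V → List (V × V) → ℕ
  neighboursIn x []             = 0
  neighboursIn x ((a , b) ∷ ps) = adjacency x a + adjacency x b + neighboursIn x ps

  neighboursIn≡length-filter : ∀ x ps → neighboursIn x ps ≡ length (filterᵇ (Adj G x) (vertices ps))
  neighboursIn≡length-filter x []             = refl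
  neighboursIn≡length-filter x ((a , b) ∷ ps) with Adj G x a
  ... | true with Adj G x b
  ...   | true  = cong (λ l → 2 + l) (neighboursIn≡length-filter x ps)
  ...   | false = cong suc (neighboursIn≡length-filter x ps)
  neighboursIn≡length-filter x ((a , b) ∷ ps) | false with Adj G x b
  ...   | true  = cong suc (neighboursIn≡length-filter x ps)
  ...   | false = neighboursIn≡length-filter x ps

  neighboursIn≤ : ∀ x ps → neighboursIn x ps ≤ length ps + length ps
  neighboursIn≤ x ps = begin
    neighboursIn x ps                           ≡⟨ neighboursIn≡length-filter x ps ⟩
    length (filterᵇ (Adj G x) (vertices ps))    ≤⟨ length-filter (T? ∘ Adj G x) (vertices ps) ⟩
    length (vertices ps)                        ≡⟨ vertices-length ps ⟩
    length ps + length ps                       ∎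
    where open ℕ.≤-Reasoning

  extend-or-saturated : ∀ {v avoid ps x} → Fan v avoid ps → x ∉ avoid → Edge G v x → x ∉ vertices ps →
    (∃ λ y → Fan v avoid ((x , y) ∷ ps)) ⊎ deg2 G v x ≤ length avoid + neighboursIn x ps
  extend-or-saturated {v} {avoid} {ps} {x} fan x∉avoid vx x∉ps
    with ⊆-or-∃-∉ Fin._≟_ (Ncommon G v x) (avoid ++ vertices ps)
  ... | inj₂ (y , y∈N , y∉) =
    let (vy , xy) = ∈Ncommon⁻ y∈N in
    inj₁ (y , fan-∷ fan (vx , vy , xy) x∉ps (y∉ ∘ ∈-++⁺ʳ avoid) x∉avoid (y∉ ∘ ∈-++⁺ˡ))
  ... | inj₁ N⊆ = inj₂ (begin
    deg2 G v x                                            ≤⟨ Unique-⊆⇒length-≤ (Ncommon-unique v x) covered ⟩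
    length (avoid ++ filterᵇ (Adj G x) (vertices ps))      ≡⟨ length-++ avoid ⟩
    length avoid + length (filterᵇ (Adj G x) (vertices ps)) ≡⟨ cong (λ l → length avoid + l) (neighboursIn≡length-filter x ps) ⟨
    length avoid + neighboursIn x ps                       ∎)
    where
    open ℕ.≤-Reasoning
    covered : ∀ {y} → y ∈ Ncommon G v x → y ∈ avoid ++ filterᵇ (Adj G x) (vertices ps)
    covered y∈N with ∈-++⁻ avoid (N⊆ y∈N)
    ... | inj₁ y∈avoid = ∈-++⁺ˡ y∈avoid
    ... | inj₂ y∈ps    = ∈-++⁺ʳ avoid (∈-filter⁺ (T? ∘ Adj G x) y∈ps (Equivalence.from T-≡ (proj₂ (∈Ncommon⁻ y∈N))))

  private
    doubled-exceeds : ∀ t p d → 2 * (suc t + p) ≤ suc d → d ≤ t + (p + p) → ⊥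
    doubled-exceeds t p d big d≤ = ℕ.m+1+n≰m (suc (t + (p + p))) (begin
      suc (t + (p + p)) + suc t  ≡⟨ rearrange t p ⟨
      2 * (suc t + p)            ≤⟨ big ⟩
      suc d                      ≤⟨ s≤s d≤ ⟩
      suc (t + (p + p))          ∎)
      where
      open ℕ.≤-Reasoning
      rearrange : ∀ t p → 2 * (suc t + p) ≡ suc (t + (p + p)) + suc t
      rearrange = solve-∀

  -- The vertices of X not yet used are avoided by the partners chosen before them.
  greedy-fan : ∀ {v ps} X → Unique X → Fan v X ps →
    (∀ {x} → x ∈ X → Edge G v x × 2 * (length ps + length X) ≤ suc (deg2 G v x)) →
    ∃ λ ps′ → Fan v [] ps′ × length ps′ ≡ length ps + length X
  greedy-fan []      _             fan _   = _ , fan-avoiding-fewer (λ ()) fan , sym (ℕ.+-identityʳ _)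
  greedy-fan {v} {ps} (x ∷ X) (x≢X ∷ uniq) fan big
    with extend-or-saturated (fan-avoiding-fewer there fan) (All¬⇒¬Any x≢X) (proj₁ (big (here refl)))
                             (λ x∈ps → avoids fan x∈ps (here refl))
  ... | inj₁ (y , fan′) =
    let (ps′ , fan″ , len) = greedy-fan X uniq fan′ big′ in ps′ , fan″ , trans len (sym (ℕ.+-suc (length ps) (length X)))
    where
    big′ : ∀ {x′} → x′ ∈ X → Edge G v x′ × 2 * (suc (length ps) + length X) ≤ suc (deg2 G v x′)
    big′ {x′} x′∈X = let (vx′ , bound) = big (there x′∈X) in
      vx′ , subst (λ t → 2 * t ≤ suc (deg2 G v x′)) (ℕ.+-suc (length ps) (length X)) bound
  ... | inj₂ saturated = contradiction saturated′ λ d≤ → doubled-exceeds (length X) (length ps) _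
      (subst (λ t → 2 * t ≤ suc (deg2 G v x)) (ℕ.+-comm (length ps) (suc (length X))) (proj₂ (big (here refl)))) d≤
    where
    saturated′ : deg2 G v x ≤ length X + (length ps + length ps)
    saturated′ = ℕ.≤-trans saturated (ℕ.+-monoʳ-≤ (length X) (neighboursIn≤ x ps))

  crossing-edges : ∀ p q a b → 2 < adjacency p a + adjacency p b + (adjacency q a + adjacency q b) →
    (Edge G p a × Edge G q b) ⊎ (Edge G p b × Edge G q a)
  crossing-edges p q a b three with Adj G p a | Adj G p b | Adj G q a | Adj G q b | three
  ... | true  | _     | _     | true  | _ = inj₁ (refl , refl)
  ... | _     | true  | true  | _     | _ = inj₂ (refl , refl)
  ... | true  | true  | false | false | s≤s (s≤s ())
  ... | true  | false | true  | false | s≤s (s≤s ())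
  ... | true  | false | false | false | s≤s ()
  ... | false | true  | false | true  | s≤s (s≤s ())
  ... | false | true  | false | false | s≤s ()
  ... | false | false | true  | true  | s≤s (s≤s ())
  ... | false | false | true  | false | s≤s ()
  ... | false | false | false | true  | s≤s ()
  ... | false | false | false | false | ()

  module _ {v : V} {avoid : List V} where

    Candidate : V → List (V × V) → Set
    Candidate x ps = x ∉ avoid × Edge G v x × x ∉ vertices ps

    private
      candidate-swap : ∀ {x a b ps} → Candidate x ((a , b) ∷ ps) → Candidate x ((b , a) ∷ ps)
      candidate-swap (x∉avoid , vx , x∉) = x∉avoid , vx , λ
        { (here refl) → x∉ (there (here refl)) ; (there (here refl)) → x∉ (here refl) ; (there (there x∈)) → x∉ (there (there x∈)) }

      candidate-tail : ∀ {x a b ps} → Candidate x ((a , b) ∷ ps) → Candidate x ps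
      candidate-tail (x∉avoid , vx , x∉) = x∉avoid , vx , x∉ ∘ there ∘ there

      fan-swap : ∀ {a b ps} → Fan v avoid ((a , b) ∷ ps) → Fan v avoid ((b , a) ∷ ps)
      fan-swap fan =
        let (va , vb , ab) = All.head (blades fan) ; (a∉ps , b∉ps) = fan-head-fresh fan in
        fan-∷ (fan-tail fan) (vb , va , Edge-sym ab) b∉ps a∉ps (avoids fan (there (here refl))) (avoids fan (here refl))

      replace-blade : ∀ {a b ps p q} → Fan v avoid ((a , b) ∷ ps) → p ≢ q →
        Candidate p ((a , b) ∷ ps) → Candidate q ((a , b) ∷ ps) → Edge G p a → Edge G q b →
        Fan v avoid ((p , a) ∷ (b , q) ∷ ps)
      replace-blade fan p≢q (p∉avoid , vp , p∉) (q∉avoid , vq , q∉) pa qb =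
        let (va , vb , ab) = All.head (blades fan) ; (a∉ps , b∉ps) = fan-head-fresh fan
            (p≢a , p∉b∷ps) = ∉-∷⁻ p∉ ; (p≢b , p∉ps) = ∉-∷⁻ p∉b∷ps
            (q≢a , q∉b∷ps) = ∉-∷⁻ q∉ ; (_ , q∉ps) = ∉-∷⁻ q∉b∷ps
        in fan-∷ (fan-∷ (fan-tail fan) (vb , vq , Edge-sym qb) b∉ps q∉ps (avoids fan (there (here refl))) q∉avoid)
                 (vp , va , pa) (∉-∷⁺ p≢b (∉-∷⁺ p≢q p∉ps)) (∉-∷⁺ (Edge⇒≢ ab) (∉-∷⁺ (q≢a ∘ sym) a∉ps))
                 p∉avoid (avoids fan (here refl))

      fewer-after-head : ∀ m c c′ N N′ → suc m + suc m < (c + N) + (c′ + N′) → c + c′ ≤ 2 → m + m < N + N′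
      fewer-after-head m c c′ N N′ more c+c′≤2 = ℕ.+-cancelˡ-< 2 (m + m) (N + N′) (begin-strict
        2 + (m + m)          ≡⟨ cong suc (ℕ.+-suc m m) ⟨
        suc m + suc m        <⟨ more ⟩
        (c + N) + (c′ + N′)  ≡⟨ regroup c N c′ N′ ⟩
        (c + c′) + (N + N′)  ≤⟨ ℕ.+-monoˡ-≤ (N + N′) c+c′≤2 ⟩
        2 + (N + N′)         ∎)
        where
        open ℕ.≤-Reasoning
        regroup : ∀ c N c′ N′ → (c + N) + (c′ + N′) ≡ (c + c′) + (N + N′)
        regroup = solve-∀

    -- A blade ab seeing three of pa, pb, qa, qb is traded for pa and bq (or pb and aq);
    -- otherwise the counting hypothesis passes to the remaining blades.
    augment : ∀ ps → Fan v avoid ps → ∀ {p q} → p ≢ q → Candidate p ps → Candidate q ps →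
      length ps + length ps < neighboursIn p ps + neighboursIn q ps →
      ∃ λ ps′ → Fan v avoid ps′ × length ps′ ≡ suc (length ps) × vertices ps′ ⊆ p ∷ q ∷ vertices ps
    augment [] _ _ _ _ ()
    augment ((a , b) ∷ ps) fan {p} {q} p≢q cp cq more
      with adjacency p a + adjacency p b + (adjacency q a + adjacency q b) ℕ.≤? 2
    ... | no ≰2 with crossing-edges p q a b (ℕ.≰⇒> ≰2)
    ...   | inj₁ (pa , qb) = _ , replace-blade fan p≢q cp cq pa qb , refl , λ
            { (here refl) → here refl ; (there (here refl)) → there (there (here refl))
            ; (there (there (here refl))) → there (there (there (here refl)))
            ; (there (there (there (here refl)))) → there (here refl)
            ; (there (there (there (there y∈)))) → there (there (there (there y∈))) }
    ...   | inj₂ (pb , qa) = _ , replace-blade (fan-swap fan) p≢q (candidate-swap cp) (candidate-swap cq) pb qa , refl , λ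
            { (here refl) → here refl ; (there (here refl)) → there (there (there (here refl)))
            ; (there (there (here refl))) → there (there (here refl))
            ; (there (there (there (here refl)))) → there (here refl)
            ; (there (there (there (there y∈)))) → there (there (there (there y∈))) }
    augment ((a , b) ∷ ps) fan {p} {q} p≢q cp cq more | yes ≤2
      with augment ps (fan-tail fan) p≢q (candidate-tail cp) (candidate-tail cq)
                   (fewer-after-head (length ps) (adjacency p a + adjacency p b) (adjacency q a + adjacency q b)
                                     (neighboursIn p ps) (neighboursIn q ps) more ≤2)
    ... | ps′ , fan′ , len , ⊆ps =
      (a , b) ∷ ps′
      , fan-∷ fan′ (All.head (blades fan)) (still-fresh (here refl) a∉ps) (still-fresh (there (here refl)) b∉ps)
              (avoids fan (here refl)) (avoids fan (there (here refl)))
      , cong suc len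
      , λ { (here refl) → there (there (here refl)) ; (there (here refl)) → there (there (there (here refl)))
          ; (there (there y∈ps′)) → weaken (⊆ps y∈ps′) }
      where
      a∉ps = proj₁ (fan-head-fresh fan)
      b∉ps = proj₂ (fan-head-fresh fan)
      still-fresh : ∀ {y} → y ∈ a ∷ b ∷ vertices ps → y ∉ vertices ps → y ∉ vertices ps′
      still-fresh y∈ab y∉ps y∈ps′ with ⊆ps y∈ps′
      ... | here refl          = proj₂ (proj₂ cp) y∈ab
      ... | there (here refl)  = proj₂ (proj₂ cq) y∈ab
      ... | there (there y∈ps) = y∉ps y∈ps
      weaken : ∀ {y} → y ∈ p ∷ q ∷ vertices ps → y ∈ p ∷ q ∷ a ∷ b ∷ vertices ps
      weaken (here refl)          = here refl
      weaken (there (here refl))  = there (here refl)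
      weaken (there (there y∈ps)) = there (there (there (there y∈ps)))

    -- Two unused vertices of D that cannot extend the fan directly each see at least r of
    -- its vertices, which is what augment needs.
    fan-of-size : ∀ r (D : List V) → Unique D → r + r ≤ length D →
      (∀ {x} → x ∈ D → x ∉ avoid × Edge G v x × length avoid + r ≤ deg2 G v x) →
      ∃ λ ps → Fan v avoid ps × length ps ≡ r
    fan-of-size r D uniqD |D| candidates = build r ℕ.≤-refl
      where
      grow : ∀ ps → Fan v avoid ps → length ps < r → ∃ λ ps′ → Fan v avoid ps′ × length ps′ ≡ suc (length ps)
      grow ps fan |ps|<r
        with ∃-∉ Fin._≟_ uniqD (subst (_< length D) (sym (vertices-length ps))
                                  (ℕ.<-≤-trans (ℕ.+-mono-< |ps|<r |ps|<r) |D|))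
      ... | x , x∈D , x∉ps
        with ∃-∉ Fin._≟_ uniqD (subst (λ l → suc l < length D) (sym (vertices-length ps))
                                  (ℕ.≤-trans (subst (_≤ r + r) (cong suc (ℕ.+-suc (length ps) (length ps)))
                                                    (ℕ.+-mono-≤ |ps|<r |ps|<r)) |D|))
      ... | z , z∈D , z∉x∷ps
        with candidates x∈D | candidates z∈D
      ... | x∉avoid , vx , rx | z∉avoid , vz , rz
        with extend-or-saturated fan x∉avoid vx x∉ps | extend-or-saturated fan z∉avoid vz (z∉x∷ps ∘ there)
      ... | inj₁ (y , fan′) | _               = _ , fan′ , refl
      ... | inj₂ _          | inj₁ (y , fan′) = _ , fan′ , refl
      ... | inj₂ x-sat      | inj₂ z-sat      =
        let (ps′ , fan′ , len , _) = augment ps fan (λ x≡z → z∉x∷ps (here (sym x≡z)))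
                                       (x∉avoid , vx , x∉ps) (z∉avoid , vz , z∉x∷ps ∘ there)
                                       (ℕ.<-≤-trans (ℕ.+-mono-< |ps|<r |ps|<r) (ℕ.+-mono-≤ (r≤ rx x-sat) (r≤ rz z-sat)))
        in ps′ , fan′ , len
        where
        r≤ : ∀ {d N} → length avoid + r ≤ d → d ≤ length avoid + N → r ≤ N
        r≤ r≤d d≤N = ℕ.+-cancelˡ-≤ (length avoid) _ _ (ℕ.≤-trans r≤d d≤N)

      build : ∀ s → s ≤ r → ∃ λ ps → Fan v avoid ps × length ps ≡ s
      build ℕ.zero    _   = [] , fan-[] , refl
      build (suc s) s<r with build s (ℕ.<⇒≤ s<r)
      ... | ps , fan , refl = grow ps fan s<r

  heavySpokes nonlightSpokes : ℕ → V → V → List V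
  heavySpokes    k u v = filterᵇ (λ x → isHeavy (classify k (deg2 G v x))) (Ncommon G u v)
  nonlightSpokes k u v = filterᵇ (λ x → not (isLight (classify k (deg2 G v x)))) (Ncommon G u v)

  module _ {m : ℕ} (free : FkFree (suc m) G) {u v : V} (uv : Edge G u v) where

    private
      fan-contradiction : ∀ {avoid ps} → Fan v avoid ps → length ps ≡ suc m → ⊥
      fan-contradiction fan len = free (subst (λ l → FkCopy l G) len (fan→copy fan))

      N = Ncommon G u v

      u∉N : u ∉ N
      u∉N u∈N = Edge⇒≢ (proj₁ (∈Ncommon⁻ u∈N)) refl

      X = take m (heavySpokes (suc m) u v)

      ∈X⁻ : ∀ {x} → x ∈ X → x ∈ N × Heavy (suc m) (deg2 G v x)
      ∈X⁻ x∈X = let (x∈N , x-heavy) = ∈-filter⁻ (T? ∘ λ x → isHeavy (classify (suc m) (deg2 G v x)))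
                                       (Sublist.lookup (take-⊆ m (heavySpokes (suc m) u v)) x∈X)
                in x∈N , isHeavy⇒Heavy {suc m} x-heavy

      length-X : m ≤ length (heavySpokes (suc m) u v) → length X ≡ m
      length-X m≤|H| = trans (length-take m (heavySpokes (suc m) u v)) (ℕ.m≤n⇒m⊓n≡m m≤|H|)

      ∈nonlight⁻ : ∀ {x} → x ∈ nonlightSpokes (suc m) u v → x ∈ N × suc m ≤ deg2 G v x
      ∈nonlight⁻ x∈NL =
        let (x∈N , x-nonlight) = ∈-filter⁻ (T? ∘ λ x → not (isLight (classify (suc m) (deg2 G v x)))) x∈NL
            (ux , vx) = ∈Ncommon⁻ x∈N
        in x∈N , ¬isLight⇒≥ x-nonlight (∈-length (∈Ncommon⁺ (Edge-sym uv) (Edge-sym ux)))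

      doubled<heavy : m + m < 2 * suc m ∸ 1
      doubled<heavy = ℕ.+-monoʳ-< m (s≤s (ℕ.≤-reflexive (sym (ℕ.+-identityʳ m))))

    -- The blade u x₀ and one blade for each of m heavy spokes would make k blades.
    few-heavy-spokes : suc m ≤ deg2 G u v → length (heavySpokes (suc m) u v) < m
    few-heavy-spokes k≤d = ℕ.≰⇒> many-heavy⇒⊥
      where
      many-heavy⇒⊥ : m ≤ length (heavySpokes (suc m) u v) → ⊥
      many-heavy⇒⊥ m≤|H|
        with ∃-∉ Fin._≟_ (Ncommon-unique u v) (subst (_< deg2 G u v) (sym (length-X m≤|H|)) k≤d)
      ... | x₀ , x₀∈N , x₀∉X
        with greedy-fan X (Unique.take⁺ m (Unique.filter⁺ _ (Ncommon-unique u v)))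
               (fan-∷ fan-[] (Edge-sym uv , proj₂ (∈Ncommon⁻ x₀∈N) , proj₁ (∈Ncommon⁻ x₀∈N))
                      (λ ()) (λ ()) (u∉N ∘ proj₁ ∘ ∈X⁻) x₀∉X)
               (λ x∈X → let (x∈N , x-heavy) = ∈X⁻ x∈X in
                  proj₂ (∈Ncommon⁻ x∈N) , subst (λ l → 2 * suc l ≤ _) (sym (length-X m≤|H|)) (s≤s x-heavy))
      ... | _ , fan , len = fan-contradiction fan (trans len (cong suc (length-X m≤|H|)))

    -- m blades avoiding u, and then a blade u w with w ∈ N(uv) outside them.
    few-nonlight-spokes : Heavy (suc m) (deg2 G u v) → length (nonlightSpokes (suc m) u v) < m + m
    few-nonlight-spokes heavy-uv = ℕ.≰⇒> many-nonlight⇒⊥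
      where
      many-nonlight⇒⊥ : m + m ≤ length (nonlightSpokes (suc m) u v) → ⊥
      many-nonlight⇒⊥ 2m≤
        with fan-of-size {v} {u ∷ []} m (nonlightSpokes (suc m) u v) (Unique.filter⁺ _ (Ncommon-unique u v)) 2m≤
               (λ x∈NL → let (x∈N , k≤vx) = ∈nonlight⁻ x∈NL in
                  ∉-∷⁺ (λ { refl → u∉N x∈N }) (λ ()) , proj₂ (∈Ncommon⁻ x∈N) , k≤vx)
      ... | ps , fan , len
        with ∃-∉ Fin._≟_ (Ncommon-unique u v)
               (subst (_< deg2 G u v) (sym (trans (vertices-length ps) (cong₂ _+_ len len)))
                      (ℕ.<-≤-trans doubled<heavy heavy-uv))
      ... | w , w∈N , w∉ps = fan-contradiction
              (fan-∷ {avoid = []} (fan-avoiding-fewer (λ ()) fan) (Edge-sym uv , proj₂ (∈Ncommon⁻ w∈N) , proj₁ (∈Ncommon⁻ w∈N))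
                     (λ u∈ps → avoids fan u∈ps (here refl)) w∉ps (λ ()) (λ ()))
              (cong suc len)

light-total : ∀ {m d p} → d ≤ m → suc p ≤ m → 3 * d + 3 * p + 9 ≤ 6 * suc m
light-total {m} {d} {p} d≤m p<m = begin
  3 * d + 3 * p + 9          ≡⟨ shift d p ⟩
  3 * d + 3 * suc p + 6      ≤⟨ ℕ.+-monoˡ-≤ 6 (ℕ.+-mono-≤ (ℕ.*-monoʳ-≤ 3 d≤m) (ℕ.*-monoʳ-≤ 3 p<m)) ⟩
  3 * m + 3 * m + 6          ≡⟨ total m ⟩
  6 * suc m                  ∎
  where
  open ℕ.≤-Reasoning
  shift : ∀ d p → 3 * d + 3 * p + 9 ≡ 3 * d + 3 * suc p + 6
  shift = solve-∀
  total : ∀ m → 3 * m + 3 * m + 6 ≡ 6 * suc m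
  total = solve-∀

medium-total : ∀ {m d h} → 2 ≤ m → d ≤ 2 * m → suc h ≤ m → 2 * d + 1 * h + 9 ≤ 6 * suc m
medium-total {m} {d} {h} 2≤m d≤2m h<m = begin
  2 * d + 1 * h + 9          ≡⟨ shift d h ⟩
  2 * d + suc h + 8          ≤⟨ ℕ.+-monoˡ-≤ 8 (ℕ.+-mono-≤ (ℕ.*-monoʳ-≤ 2 d≤2m) h<m) ⟩
  2 * (2 * m) + m + 8        ≤⟨ ℕ.+-monoʳ-≤ (2 * (2 * m) + m) (ℕ.+-monoˡ-≤ 6 2≤m) ⟩
  2 * (2 * m) + m + (m + 6)  ≡⟨ total m ⟩
  6 * suc m                  ∎
  where
  open ℕ.≤-Reasoning
  shift : ∀ d h → 2 * d + 1 * h + 9 ≡ 2 * d + suc h + 8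
  shift = solve-∀
  total : ∀ m → 2 * (2 * m) + m + (m + 6) ≡ 6 * suc m
  total = solve-∀

heavy-total : ∀ {m h} → suc h ≤ m + m → 3 * h + 9 ≤ 6 * suc m
heavy-total {m} {h} h<2m = begin
  3 * h + 9                  ≡⟨ shift h ⟩
  3 * suc h + 6              ≤⟨ ℕ.+-monoˡ-≤ 6 (ℕ.*-monoʳ-≤ 3 h<2m) ⟩
  3 * (m + m) + 6            ≡⟨ total m ⟩
  6 * suc m                  ∎
  where
  open ℕ.≤-Reasoning
  shift : ∀ h → 3 * h + 9 ≡ 3 * suc h + 6
  shift = solve-∀
  total : ∀ m → 3 * (m + m) + 6 ≡ 6 * suc m
  total = solve-∀

module _ {n : ℕ} (G : Graph n) {m : ℕ} (free : FkFree (suc m) G) {u v : Fin n} (uv : Edge G u v) where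

  private
    k = suc m
    N = Ncommon G u v
    d = deg2 G u v

  uxClass vxClass : Fin n → EdgeClass
  uxClass x = classify (suc m) (deg2 G u x)
  vxClass x = classify (suc m) (deg2 G v x)

  spokeWeight : EdgeClass → Fin n → ℕ
  spokeWeight A x = classWeight A (uxClass x) (vxClass x)

  spokeSum : EdgeClass → ℕ
  spokeSum A = sum (map (spokeWeight A) (Ncommon G u v))

  weightSum≡sixths : weightSum (suc m) G u v ≡ sixths (spokeSum (classify (suc m) (deg2 G u v)))
  weightSum≡sixths = trans (cong sumℚ (map-cong (λ x → weight≡classWeight m d (deg2 G u x) (deg2 G v x)) N))
                           (sumℚ-sixths _ N)

  private
    specialSpoke : Fin n → Bool
    specialSpoke x = isHeavy (vxClass x) ∧ isLight (uxClass x)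

  spokeSum-special : Special k G u v → spokeSum light ≡ 6 * m
  spokeSum-special (_ , d≡m , spokes) = trans (sum-constant _ 6 N six) (cong (6 *_) d≡m)
    where
    six : ∀ {x} → x ∈ N → spokeWeight light x ≡ 6
    six x∈N = let (ux , vx) = ∈Ncommon⁻ G x∈N ; (heavy-vx , light-ux) = spokes _ ux vx in
      cong₂ (classWeight light) (classify-light {k} light-ux) (classify-heavy {m} heavy-vx)

  few-special-spokes : Light k d → ¬ Special k G u v → length (filterᵇ specialSpoke N) < m
  few-special-spokes light-d ¬special with d ℕ.≟ m
  ... | no d≢m = ℕ.≤-<-trans (length-filter (T? ∘ specialSpoke) N) (ℕ.≤∧≢⇒< (proj₂ light-d) d≢m)
  ... | yes d≡m with all? (T? ∘ specialSpoke) N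
  ...   | yes all-special = contradiction (light-d , d≡m , spokes) ¬special
    where
    spokes : ∀ x → Edge G u x → Edge G v x → Heavy k (deg2 G v x) × Light k (deg2 G u x)
    spokes x ux vx = let (h , l) = Equivalence.to T-∧ (All.lookup all-special (∈Ncommon⁺ G ux vx)) in
      isHeavy⇒Heavy {k} h , isLight⇒Light {k} l
  ...   | no ¬all-special = subst (length (filterᵇ specialSpoke N) <_) d≡m
                              (filter-notAll (T? ∘ specialSpoke) N (¬All⇒Any¬ (T? ∘ specialSpoke) N ¬all-special))

  spokeSum-bound : 2 ≤ m → ¬ Special k G u v → spokeSum (classify k d) + 9 ≤ 6 * k
  spokeSum-bound 2≤m ¬special with classify k d | classification k d
  ... | light | light light-d = begin
    spokeSum light + 9                              ≤⟨ ℕ.+-monoˡ-≤ 9 (sum-≤-indicator _ specialSpoke 3 3 N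
                                                         (λ {x} _ → classWeight-light (uxClass x) (vxClass x))) ⟩
    3 * d + 3 * length (filterᵇ specialSpoke N) + 9 ≤⟨ light-total (proj₂ light-d) (few-special-spokes light-d ¬special) ⟩
    6 * k                                           ∎
    where open ℕ.≤-Reasoning
  ... | medium | medium ¬light-d ¬heavy-d = begin
    spokeSum medium + 9                             ≤⟨ ℕ.+-monoˡ-≤ 9 (sum-≤-indicator _ (isHeavy ∘ vxClass) 2 1 N
                                                         (λ {x} _ → classWeight-medium (uxClass x) (vxClass x))) ⟩
    2 * d + 1 * length (heavySpokes G k u v) + 9    ≤⟨ medium-total 2≤m d≤2m few-heavy ⟩
    6 * k                                           ∎
    where
    open ℕ.≤-Reasoning
    d≤2m : d ≤ 2 * m
    d≤2m = ℕ.s≤s⁻¹ (subst (suc d ≤_) (ℕ.+-suc m (m + 0)) (ℕ.≰⇒> ¬heavy-d))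
    few-heavy : length (heavySpokes G k u v) < m
    few-heavy with 1 ℕ.≤? d
    ... | yes 1≤d = few-heavy-spokes G free uv (¬Light⇒≥ ¬light-d 1≤d)
    ... | no 1≰d  = ℕ.≤-<-trans (length-filter _ N) (ℕ.<-≤-trans (ℕ.≰⇒> 1≰d) (ℕ.≤-trans (s≤s z≤n) 2≤m))
  ... | heavy | heavy _ heavy-d = begin
    spokeSum heavy + 9                              ≤⟨ ℕ.+-monoˡ-≤ 9 (sum-≤-indicator _ (not ∘ isLight ∘ vxClass) 0 3 N
                                                         (λ {x} _ → classWeight-heavy (uxClass x) (vxClass x))) ⟩
    3 * length (nonlightSpokes G k u v) + 9         ≤⟨ heavy-total (few-nonlight-spokes G free uv heavy-d) ⟩
    6 * k                                           ∎
    where open ℕ.≤-Reasoning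

  weightSum-special : Special k G u v → weightSum k G u v ≡ (+ k / 1) - 1ℚ
  weightSum-special special@(light-d , _) = begin
    weightSum k G u v              ≡⟨ weightSum≡sixths ⟩
    sixths (spokeSum (classify k d)) ≡⟨ cong (λ A → sixths (spokeSum A)) (classify-light {k} light-d) ⟩
    sixths (spokeSum light)        ≡⟨ cong sixths (spokeSum-special special) ⟩
    sixths (6 * m)                 ≡⟨ integer-minus-sixths k 6 (6 * m) (one-more m) ⟨
    (+ k / 1) - sixths 6           ≡⟨ cong (λ q → (+ k / 1) - q) sixths-6≡1ℚ ⟩
    (+ k / 1) - 1ℚ                 ∎
    where
    open ≡-Reasoning
    one-more : ∀ m → 6 * m + 6 ≡ 6 * suc m
    one-more = solve-∀

  weightSum-nonspecial : 2 ≤ m → ¬ Special k G u v → weightSum k G u v ≤ℚ (+ k / 1) - (+ 3 / 2)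
  weightSum-nonspecial 2≤m ¬special =
    subst₂ _≤ℚ_ (sym weightSum≡sixths) (cong (λ q → (+ k / 1) - q) sixths-9≡3/2)
      (sixths≤integer-minus-sixths k 9 _ (spokeSum-bound 2≤m ¬special))

lemma2 : (k : ℕ) → 3 ≤ k → (n : ℕ) (G : Graph n) → FkFree k G →
    (u v : Fin n) → Edge G u v →
    (Special k G u v → weightSum k G u v ≡ (+ k / 1) - 1ℚ) ×
    (¬ Special k G u v → weightSum k G u v ≤ℚ (+ k / 1) - (+ 3 / 2))
lemma2 (suc m) (s≤s 2≤m) n G free u v uv = weightSum-special G free uv , weightSum-nonspecial G free uv 2≤m
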